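{- Let $\mathcal{A}_H$ be the Hall affine plane of order $q^2$ with defining polynomial $f(x)=x^2-rx-s$. (i) Let $\ell,\ell'$ be two distinct intersecting lines, both in $NBF$, and let $A$ be a point of $\ell$ other than $\ell\cap\ell'$. Then there exist $\mu,\psi\in F$ with $\psi\neq0$ and a collineation $\phi$ of $\mathcal{A}_H$ with $\phi(\ell)=\ell_1$, $\phi(\ell')=\ell_2$ and $\phi(A)=\left((0,1),\left(-\frac{\mu^2-r\mu-s}{\psi},\,r-\mu\right)\right)$, where $\ell_1$ is the line $\mathbf y=\mathbf x\,(\mu,\psi)$ and $\ell_2$ is the line $\mathbf y=\mathbf x\,(0,1)$. (ii) Let $\ell,\ell'$ be two distinct parallel lines, both in $NBF$, and let $A$ be a point of $\ell$. Then there exist $\boldsymbol\kappa=(\kappa_1,\kappa_2)\in H$ and a collineation $\phi$ of $\mathcal{A}_H$ with $\phi(\ell)=\ell_1$, $\phi(\ell')=\ell_2$ and $\phi(A)=((0,1),(\kappa_1+s,\kappa_2+r))$, where $\ell_1$ is the line $\mathbf y=\mathbf x\,(0,1)+\boldsymbol\kappa$ and $\ell_2$ is the line $\mathbf y=\mathbf x\,(0,1)$.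
   Context: Let $F=F_q$ ($q$ a prime power) and $f(x)=x^2-rx-s$, $r,s\in F$, irreducible over $F$. The Hall system is $H=F^2$ with componentwise addition and multiplication $\mathbf a\mathbf b=(a_1b_1,a_2b_1)$ if $b_2=0$, and $\mathbf a\mathbf b=(a_1b_1-a_2b_2^{ -1}f(b_1),\,a_1b_2-a_2b_1+a_2r)$ if $b_2\neq0$. The Hall affine plane $\mathcal{A}_H$ has points $(\mathbf x,\mathbf y)\in H\times H$ and lines $\{(\mathbf x,\mathbf x\mathbf m+\mathbf k):\mathbf x\in H\}$ ($\mathbf m,\mathbf k\in H$; type 1 if $m_2=0$, type 2 if $m_2\neq0$) and vertical lines $\{(\mathbf c,\mathbf y):\mathbf y\in H\}$. $NBF$ is the set of type 2 lines. A collineation is a bijection of the point set mapping lines onto lines. -}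

module Defs where

open import Level using (0ℓ)
open import Data.Nat using (ℕ)
open import Data.Fin using (Fin)
import Data.Fin as Fin
open import Data.Product using (Σ; ∃; _×_; _,_; proj₁; proj₂)
open import Data.Empty using (⊥)
open import Relation.Nullary using (¬_; Dec; yes; no)
open import Relation.Binary.PropositionalEquality using (_≡_; refl; cong; sym; trans)
open import Algebra.Structures using (IsCommutativeRing)
open import Function.Bundles using (_↔_; Inverse; _⇔_)
open import Function.Definitions using (Bijective)

-- A finite field F = F_q: a commutative ring (w.r.t. propositional equality)
-- with 0 ≠ 1 in which every nonzero element is invertible, whose carrier is
-- in bijection with Fin q for some natural number q.
-- (The inverse is a total function; its value at 0 is irrelevant.)
record FiniteField : Set₁ where
  infixl 7 _*_
  infixl 6 _+_ _-_
  infix  8 -_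
  infix  9 _⁻¹
  field
    Carrier  : Set
    _+_ _*_  : Carrier → Carrier → Carrier
    -_       : Carrier → Carrier
    0# 1#    : Carrier
    _⁻¹      : Carrier → Carrier
    isCommutativeRing : IsCommutativeRing _≡_ _+_ _*_ -_ 0# 1#
    0≢1      : ¬ (0# ≡ 1#)
    inverseʳ : ∀ x → ¬ (x ≡ 0#) → x * (x ⁻¹) ≡ 1#
    q        : ℕ
    enum     : Carrier ↔ Fin q

  _-_ : Carrier → Carrier → Carrier
  x - y = x + (- y)

  _≟_ : (x y : Carrier) → Dec (x ≡ y)
  x ≟ y with Fin._≟_ (Inverse.to enum x) (Inverse.to enum y)
  ... | yes p = yes (trans (sym (Inverse.strictlyInverseʳ enum x))
                      (trans (cong (Inverse.from enum) p) (Inverse.strictlyInverseʳ enum y)))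
  ... | no ¬p = no (λ e → ¬p (cong (Inverse.to enum) e))


-- f(x) = x² - r x - s is irreducible over F: it is not a product of two
-- polynomials of degree 1, i.e. there are no c,d,e,g with
-- (c x + d)(e x + g) = x² - r x - s (comparison of coefficients).
Irreducible : (F : FiniteField) → FiniteField.Carrier F → FiniteField.Carrier F → Set
Irreducible F r s =
  ¬ (Σ Carrier λ c → Σ Carrier λ d → Σ Carrier λ e → Σ Carrier λ g →
       (c * e ≡ 1#) × (c * g + d * e ≡ - r) × (d * g ≡ - s))
  where open FiniteField F

module Hall (F : FiniteField) (r s : FiniteField.Carrier F) where
  open FiniteField F

  f : Carrier → Carrier
  f x = x * x - r * x - s

  H : Set
  H = Carrier × Carrier

  infixl 6 _⊕_
  infixl 7 _⊙_

  _⊕_ : H → H → H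
  (a₁ , a₂) ⊕ (b₁ , b₂) = (a₁ + b₁ , a₂ + b₂)

  _⊙_ : H → H → H
  (a₁ , a₂) ⊙ (b₁ , b₂) with b₂ ≟ 0#
  ... | yes _ = (a₁ * b₁ , a₂ * b₁)
  ... | no  _ = (a₁ * b₁ - a₂ * (b₂ ⁻¹) * f b₁ , a₁ * b₂ - a₂ * b₁ + a₂ * r)

  Point : Set
  Point = H × H

  data Line : Set where
    nonvert : (m k : H) → Line
    vert    : (c : H) → Line

  infix 4 _∈L_
  _∈L_ : Point → Line → Set
  (x , y) ∈L nonvert m k = y ≡ x ⊙ m ⊕ k
  (x , y) ∈L vert c      = x ≡ c

  InNBF : Line → Set
  InNBF (nonvert m k) = ¬ (proj₂ m ≡ 0#)
  InNBF (vert c)      = ⊥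

  SameLine : Line → Line → Set
  SameLine ℓ ℓ' = ∀ P → (P ∈L ℓ ⇔ P ∈L ℓ')

  MapsOnto : (Point → Point) → Line → Line → Set
  MapsOnto φ ℓ ℓ' = ∀ Q → (Q ∈L ℓ' ⇔ ∃ λ P → P ∈L ℓ × φ P ≡ Q)

  Collineation : (Point → Point) → Set
  Collineation φ = Bijective _≡_ _≡_ φ × (∀ ℓ → ∃ λ ℓ' → MapsOnto φ ℓ ℓ')

  zeroH : H
  zeroH = (0# , 0#)

  e₂ : H
  e₂ = (0# , 1#)

{-# OPTIONS --safe #-}
-- Identify H with F² as row vectors. For a slope m of type 2, x ↦ x m is right multiplication
-- by a matrix with trace r and determinant -s, i.e. with characteristic polynomial f; type 1
-- slopes act as scalars. Translations and the maps (x , y) ↦ (x T , y T), T invertible, are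
-- collineations: the latter conjugate slope matrices, and as f is irreducible a matrix with
-- trace r and determinant -s is determined by its first row, so the conjugate of a slope matrix
-- is again one. Since f has no root, a type 2 slope matrix M has no eigenvector, so for u ≠ 0 the
-- vectors u, u M form a basis; passing to it sends M to the matrix of e₂ and u M to e₂.
-- (i) Translate ℓ ∩ ℓ′ to the origin and change basis, with M the matrix of ℓ′ and u M the
-- translated abscissa of A. (ii) Disjoint type 2 lines have the same slope, otherwise
-- x (M - M′) = k′ - k is solvable or, by Cayley–Hamilton, M and M′ agree on a basis. Translate the
-- point of ℓ′ below A to the origin, change basis to make the slope e₂, and translate by
-- (e₂ , e₂ ⊙ e₂), which fixes every line of slope e₂.
module Submission where

open import Defs
open import Data.Product using (Σ; ∃; _×_; _,_)
open import Relation.Nullary using (¬_)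
open import Relation.Binary.PropositionalEquality using (_≡_)

open import Level using (0ℓ)
open import Algebra.Bundles using (CommutativeRing)
open import Algebra.Solver.Ring.AlmostCommutativeRing
  using (_-Raw-AlmostCommutative⟶_; fromCommutativeRing)
open import Data.Empty using (⊥; ⊥-elim)
open import Data.Integer as ℤ using (ℤ; +_; -[1+_]; +[1+_])
import Data.Integer.Properties as ℤP
open import Data.Maybe using (Maybe; just; nothing)
open import Data.Nat as ℕ using (zero; suc)
import Data.Nat.Properties as ℕP
open import Data.Product using (proj₁; proj₂)
open import Data.Product.Properties using (≡-dec)
open import Data.Sum using (_⊎_; inj₁; inj₂)
open import Function.Base using (_∘_)
open import Function.Bundles
  using (_↔_; _⇔_; mk↔ₛ′; mk⇔; module Inverse; module Equivalence; module Bijection)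
open import Function.Construct.Composition using (_↔-∘_; _⇔-∘_)
open import Function.Properties.Inverse using (Inverse⇒Bijection)
open import Relation.Nullary using (Dec; yes; no)
open import Relation.Binary.PropositionalEquality
  using (_≢_; refl; sym; trans; cong; cong₂; subst; module ≡-Reasoning)

-- Ring equations are normalised with integer coefficients, which compute, unlike coefficients
-- in an abstract carrier. The optimised multiple n ×ₙ 1# makes fromℤ 1 definitionally 1#.
module IntegerCoefficientSolver {c ℓ} (R : CommutativeRing c ℓ) where
  open CommutativeRing R hiding (refl; sym; trans; reflexive)
  open CommutativeRing R using ()
    renaming (refl to ≈-refl; sym to ≈-sym; trans to ≈-trans; reflexive to ≈-reflexive)
  open import Algebra.Properties.Ring ring
    using (-‿involutive; -0#≈0#; -‿+-comm; -‿distribˡ-*; -‿distribʳ-*)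
  open import Algebra.Properties.Semiring.Mult.TCOptimised semiring using (1+×; ×-homo-+; ×1-homo-*)
    renaming (_×_ to _×ₙ_)
  open import Relation.Binary.Reasoning.Setoid setoid

  fromℤ : ℤ → Carrier
  fromℤ (+ n)    = n ×ₙ 1#
  fromℤ -[1+ n ] = - (suc n ×ₙ 1#)

  fromℤ-neg : ∀ i → fromℤ (ℤ.- i) ≈ - fromℤ i
  fromℤ-neg (+ zero)  = ≈-sym -0#≈0#
  fromℤ-neg +[1+ n ]  = ≈-refl
  fromℤ-neg -[1+ n ]  = ≈-sym (-‿involutive _)

  x+a-[x+b]≈a-b : ∀ x a b → (x + a) - (x + b) ≈ a - b
  x+a-[x+b]≈a-b x a b = begin
    (x + a) - (x + b)      ≈⟨ +-congˡ (-‿+-comm x b) ⟨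
    (x + a) + (- x - b)    ≈⟨ +-congʳ (+-comm x a) ⟩
    (a + x) + (- x - b)    ≈⟨ +-assoc a x _ ⟩
    a + (x + (- x - b))    ≈⟨ +-congˡ (+-assoc x (- x) (- b)) ⟨
    a + ((x - x) - b)      ≈⟨ +-congˡ (+-congʳ (-‿inverseʳ x)) ⟩
    a + (0# - b)           ≈⟨ +-congˡ (+-identityˡ (- b)) ⟩
    a - b                  ∎

  fromℤ-⊖ : ∀ m n → fromℤ (m ℤ.⊖ n) ≈ m ×ₙ 1# - n ×ₙ 1#
  fromℤ-⊖ m       zero    = ≈-sym (≈-trans (+-congˡ -0#≈0#) (+-identityʳ _))
  fromℤ-⊖ zero    (suc n) = ≈-sym (+-identityˡ _)
  fromℤ-⊖ (suc m) (suc n) = begin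
    fromℤ (suc m ℤ.⊖ suc n)  ≡⟨ cong fromℤ (ℤP.[1+m]⊖[1+n]≡m⊖n m n) ⟩
    fromℤ (m ℤ.⊖ n)          ≈⟨ fromℤ-⊖ m n ⟩
    m ×ₙ 1# - n ×ₙ 1#                    ≈⟨ x+a-[x+b]≈a-b 1# _ _ ⟨
    (1# + m ×ₙ 1#) - (1# + n ×ₙ 1#)      ≈⟨ +-cong (1+× m 1#) (-‿cong (1+× n 1#)) ⟨
    suc m ×ₙ 1# - suc n ×ₙ 1#            ∎

  fromℤ-+ : ∀ i j → fromℤ (i ℤ.+ j) ≈ fromℤ i + fromℤ j
  fromℤ-+ (+ m)    (+ n)    = ×-homo-+ 1# m n
  fromℤ-+ (+ m)    -[1+ n ] = fromℤ-⊖ m (suc n)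
  fromℤ-+ -[1+ m ] (+ n)    = ≈-trans (fromℤ-⊖ n (suc m)) (+-comm _ _)
  fromℤ-+ -[1+ m ] -[1+ n ] = begin
    - (suc (suc (m ℕ.+ n)) ×ₙ 1#)   ≡⟨ cong (λ k → - (suc k ×ₙ 1#)) (ℕP.+-suc m n) ⟨
    - ((suc m ℕ.+ suc n) ×ₙ 1#)     ≈⟨ -‿cong (×-homo-+ 1# (suc m) (suc n)) ⟩
    - (suc m ×ₙ 1# + suc n ×ₙ 1#)    ≈⟨ -‿+-comm _ _ ⟨
    - (suc m ×ₙ 1#) - suc n ×ₙ 1#    ∎

  fromℤ-pos-* : ∀ m n → fromℤ (+ m ℤ.* + n) ≈ m ×ₙ 1# * n ×ₙ 1#
  fromℤ-pos-* m n = ≈-trans (≈-reflexive (cong fromℤ (sym (ℤP.pos-* m n)))) (×1-homo-* m n)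

  fromℤ-+* : ∀ m j → fromℤ (+ m ℤ.* j) ≈ m ×ₙ 1# * fromℤ j
  fromℤ-+* m (+ n)    = fromℤ-pos-* m n
  fromℤ-+* m -[1+ n ] = begin
    fromℤ (+ m ℤ.* -[1+ n ])         ≡⟨ cong fromℤ (ℤP.neg-distribʳ-* (+ m) +[1+ n ]) ⟨
    fromℤ (ℤ.- (+ m ℤ.* +[1+ n ]))   ≈⟨ fromℤ-neg (+ m ℤ.* +[1+ n ]) ⟩
    - fromℤ (+ m ℤ.* +[1+ n ])       ≈⟨ -‿cong (fromℤ-pos-* m (suc n)) ⟩
    - (m ×ₙ 1# * suc n ×ₙ 1#)          ≈⟨ -‿distribʳ-* _ _ ⟩
    m ×ₙ 1# * - (suc n ×ₙ 1#)          ∎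

  fromℤ-* : ∀ i j → fromℤ (i ℤ.* j) ≈ fromℤ i * fromℤ j
  fromℤ-* (+ m)    j = fromℤ-+* m j
  fromℤ-* -[1+ m ] j = begin
    fromℤ (-[1+ m ] ℤ.* j)           ≡⟨ cong fromℤ (ℤP.neg-distribˡ-* +[1+ m ] j) ⟨
    fromℤ (ℤ.- (+[1+ m ] ℤ.* j))     ≈⟨ fromℤ-neg (+[1+ m ] ℤ.* j) ⟩
    - fromℤ (+[1+ m ] ℤ.* j)         ≈⟨ -‿cong (fromℤ-+* (suc m) j) ⟩
    - (suc m ×ₙ 1# * fromℤ j)         ≈⟨ -‿distribˡ-* _ _ ⟩
    - (suc m ×ₙ 1#) * fromℤ j         ∎

  homomorphism : ℤ.+-*-rawRing -Raw-AlmostCommutative⟶ fromCommutativeRing R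
  homomorphism = record
    { ⟦_⟧    = fromℤ
    ; +-homo = fromℤ-+
    ; *-homo = fromℤ-*
    ; -‿homo = fromℤ-neg
    ; 0-homo = ≈-refl
    ; 1-homo = ≈-refl
    }

  fromℤ-≟ : ∀ i j → Maybe (fromℤ i ≈ fromℤ j)
  fromℤ-≟ i j with i ℤ.≟ j
  ... | yes refl = just ≈-refl
  ... | no _       = nothing

  open import Algebra.Solver.Ring ℤ.+-*-rawRing (fromCommutativeRing R) homomorphism fromℤ-≟ public

module FieldProperties (F : FiniteField) where
  open FiniteField F
  open ≡-Reasoning

  commutativeRing : CommutativeRing 0ℓ 0ℓ
  commutativeRing = record { isCommutativeRing = isCommutativeRing }

  open CommutativeRing commutativeRing public
    using (+-comm; +-identityˡ; +-identityʳ; -‿inverseʳ; *-comm; *-assoc; *-identityˡ; zeroʳ)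
  open IntegerCoefficientSolver commutativeRing public
    using (solve; Polynomial; con; _:=_; _:+_; _:*_; _:-_; :-_)

  :0 :1 : ∀ {n} → Polynomial n
  :0 = con (+ 0)
  :1 = con (+ 1)

  1≢0 : 1# ≢ 0#
  1≢0 = 0≢1 ∘ sym

  inverseˡ : ∀ {x} → x ≢ 0# → x ⁻¹ * x ≡ 1#
  inverseˡ {x} x≢0 = trans (*-comm (x ⁻¹) x) (inverseʳ x x≢0)

  1⁻¹≡1 : 1# ⁻¹ ≡ 1#
  1⁻¹≡1 = trans (sym (*-identityˡ (1# ⁻¹))) (inverseʳ 1# 1≢0)

  x≡x*y⁻¹*y : ∀ x {y} → y ≢ 0# → x ≡ x * y ⁻¹ * y
  x≡x*y⁻¹*y x {y} y≢0 = begin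
    x              ≡⟨ solve 1 (λ x → x := x :* :1) refl x ⟩
    x * 1#         ≡⟨ cong (x *_) (inverseˡ y≢0) ⟨
    x * (y ⁻¹ * y) ≡⟨ *-assoc x (y ⁻¹) y ⟨
    x * y ⁻¹ * y   ∎

  *-cancelˡ : ∀ x {a b} → x ≢ 0# → x * a ≡ x * b → a ≡ b
  *-cancelˡ x {a} {b} x≢0 xa≡xb = begin
    a              ≡⟨ *-identityˡ a ⟨
    1# * a         ≡⟨ cong (_* a) (inverseˡ x≢0) ⟨
    x ⁻¹ * x * a   ≡⟨ *-assoc (x ⁻¹) x a ⟩
    x ⁻¹ * (x * a) ≡⟨ cong (x ⁻¹ *_) xa≡xb ⟩
    x ⁻¹ * (x * b) ≡⟨ *-assoc (x ⁻¹) x b ⟨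
    x ⁻¹ * x * b   ≡⟨ cong (_* b) (inverseˡ x≢0) ⟩
    1# * b         ≡⟨ *-identityˡ b ⟩
    b              ∎

  x*y≡0⇒x≡0 : ∀ {x y} → y ≢ 0# → x * y ≡ 0# → x ≡ 0#
  x*y≡0⇒x≡0 {x} {y} y≢0 xy≡0 = *-cancelˡ y y≢0 (begin
    y * x  ≡⟨ *-comm y x ⟩
    x * y  ≡⟨ xy≡0 ⟩
    0#     ≡⟨ zeroʳ y ⟨
    y * 0# ∎)

  x-y≡0⇒x≡y : ∀ {x y} → x - y ≡ 0# → x ≡ y
  x-y≡0⇒x≡y {x} {y} x-y≡0 = begin
    x          ≡⟨ solve 2 (λ x y → x := x :- y :+ y) refl x y ⟩
    x - y + y  ≡⟨ cong (_+ y) x-y≡0 ⟩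
    0# + y     ≡⟨ +-identityˡ y ⟩
    y          ∎

  proportional : ∀ {a b x y} → a ≢ 0# → a * y ≡ b * x → y ≡ x * a ⁻¹ * b
  proportional {a} {b} {x} {y} a≢0 ay≡bx = *-cancelˡ a a≢0 (begin
    a * y               ≡⟨ ay≡bx ⟩
    b * x               ≡⟨ cong (b *_) (x≡x*y⁻¹*y x a≢0) ⟩
    b * (x * a ⁻¹ * a)  ≡⟨ solve 4 (λ a b x v → b :* (x :* v :* a) := a :* (x :* v :* b))
                                   refl a b x (a ⁻¹) ⟩
    a * (x * a ⁻¹ * b)  ∎)

module HallPlane (F : FiniteField) (r s : FiniteField.Carrier F) where
  open FiniteField F
  open FieldProperties F
  open Hall F r s
  open ≡-Reasoning

  infix  8 -ᴴ_
  infixl 6 _⊖_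
  infixr 7 _⋆_

  -ᴴ_ : H → H
  -ᴴ (x₁ , x₂) = (- x₁ , - x₂)

  _⊖_ : H → H → H
  x ⊖ y = x ⊕ -ᴴ y

  _⋆_ : Carrier → H → H
  k ⋆ (x₁ , x₂) = (k * x₁ , k * x₂)

  e₁ : H
  e₁ = (1# , 0#)

  e₁≢0 : e₁ ≢ zeroH
  e₁≢0 = 1≢0 ∘ cong proj₁

  _≟ᴴ_ : (x y : H) → Dec (x ≡ y)
  _≟ᴴ_ = ≡-dec _≟_ _≟_

  nonzero-component : ∀ {u} → u ≢ zeroH → proj₁ u ≢ 0# ⊎ proj₂ u ≢ 0#
  nonzero-component {u₁ , u₂} u≢0 with u₁ ≟ 0#
  ... | no  u₁≢0 = inj₁ u₁≢0
  ... | yes u₁≡0 = inj₂ (λ u₂≡0 → u≢0 (cong₂ _,_ u₁≡0 u₂≡0))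

  ⊕-comm : ∀ x y → x ⊕ y ≡ y ⊕ x
  ⊕-comm (x₁ , x₂) (y₁ , y₂) = cong₂ _,_ (+-comm x₁ y₁) (+-comm x₂ y₂)

  ⊕-identityˡ : ∀ x → zeroH ⊕ x ≡ x
  ⊕-identityˡ (x₁ , x₂) = cong₂ _,_ (+-identityˡ x₁) (+-identityˡ x₂)

  ⊕-identityʳ : ∀ x → x ⊕ zeroH ≡ x
  ⊕-identityʳ (x₁ , x₂) = cong₂ _,_ (+-identityʳ x₁) (+-identityʳ x₂)

  ⊖-self : ∀ x → x ⊖ x ≡ zeroH
  ⊖-self (x₁ , x₂) = cong₂ _,_ (-‿inverseʳ x₁) (-‿inverseʳ x₂)

  ⊕-⊖-cancel : ∀ x u → x ⊕ u ⊖ u ≡ x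
  ⊕-⊖-cancel (x₁ , x₂) (u₁ , u₂) = cong₂ _,_ (cancel x₁ u₁) (cancel x₂ u₂)
    where
    cancel : ∀ x u → x + u - u ≡ x
    cancel = solve 2 (λ x u → x :+ u :- u := x) refl

  ⊖-⊕-cancel : ∀ x u → x ⊖ u ⊕ u ≡ x
  ⊖-⊕-cancel (x₁ , x₂) (u₁ , u₂) = cong₂ _,_ (cancel x₁ u₁) (cancel x₂ u₂)
    where
    cancel : ∀ x u → x - u + u ≡ x
    cancel = solve 2 (λ x u → x :- u :+ u := x) refl

  ⊕-cancelʳ : ∀ u {x y} → x ⊕ u ≡ y ⊕ u → x ≡ y
  ⊕-cancelʳ u {x} {y} x+u≡y+u = begin
    x          ≡⟨ ⊕-⊖-cancel x u ⟨
    x ⊕ u ⊖ u  ≡⟨ cong (_⊖ u) x+u≡y+u ⟩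
    y ⊕ u ⊖ u  ≡⟨ ⊕-⊖-cancel y u ⟩
    y          ∎

  ⊖≡0⇒≡ : ∀ {x y} → x ⊖ y ≡ zeroH → x ≡ y
  ⊖≡0⇒≡ {x} {y} x-y≡0 = begin
    x          ≡⟨ ⊖-⊕-cancel x y ⟨
    x ⊖ y ⊕ y  ≡⟨ cong (_⊕ y) x-y≡0 ⟩
    zeroH ⊕ y  ≡⟨ ⊕-identityˡ y ⟩
    y          ∎

  k⋆u≡0⇒k≡0 : ∀ {k u} → u ≢ zeroH → k ⋆ u ≡ zeroH → k ≡ 0#
  k⋆u≡0⇒k≡0 u≢0 ku≡0 with nonzero-component u≢0
  ... | inj₁ u₁≢0 = x*y≡0⇒x≡0 u₁≢0 (cong proj₁ ku≡0)
  ... | inj₂ u₂≢0 = x*y≡0⇒x≡0 u₂≢0 (cong proj₂ ku≡0)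

  -- 2 × 2 matrices, acting on row vectors from the right

  record Mat : Set where
    constructor mat
    field m₁₁ m₁₂ m₂₁ m₂₂ : Carrier

  infixl 7 _·_ _*ᴹ_
  infixl 6 _-ᴹ_

  _·_ : H → Mat → H
  (x₁ , x₂) · mat a b c d = (x₁ * a + x₂ * c , x₁ * b + x₂ * d)

  _*ᴹ_ : Mat → Mat → Mat
  mat a b c d *ᴹ mat a′ b′ c′ d′ =
    mat (a * a′ + b * c′) (a * b′ + b * d′) (c * a′ + d * c′) (c * b′ + d * d′)

  _-ᴹ_ : Mat → Mat → Mat
  mat a b c d -ᴹ mat a′ b′ c′ d′ = mat (a - a′) (b - b′) (c - c′) (d - d′)

  rows : H → H → Mat
  rows (a , b) (c , d) = mat a b c d

  row₁ row₂ : Mat → H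
  row₁ (mat a b _ _) = (a , b)
  row₂ (mat _ _ c d) = (c , d)

  1ᴹ : Mat
  1ᴹ = rows e₁ e₂

  scalar : Carrier → Mat
  scalar k = mat k 0# 0# k

  det tr : Mat → Carrier
  det (mat a b c d) = a * d - b * c
  tr  (mat a _ _ d) = a + d

  -- Meaningful only when det A ≢ 0#.
  inverse : Mat → Mat
  inverse A@(mat a b c d) = mat (δ * d) (δ * - b) (δ * - c) (δ * a)
    where δ = det A ⁻¹

  e₁-· : ∀ A → e₁ · A ≡ row₁ A
  e₁-· (mat a b c d) = cong₂ _,_ (pick a c) (pick b d)
    where
    pick : ∀ a c → 1# * a + 0# * c ≡ a
    pick = solve 2 (λ a c → :1 :* a :+ :0 :* c := a) refl

  e₂-· : ∀ A → e₂ · A ≡ row₂ A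
  e₂-· (mat a b c d) = cong₂ _,_ (pick a c) (pick b d)
    where
    pick : ∀ a c → 0# * a + 1# * c ≡ c
    pick = solve 2 (λ a c → :0 :* a :+ :1 :* c := c) refl

  zero-· : ∀ A → zeroH · A ≡ zeroH
  zero-· (mat a b c d) = cong₂ _,_ (vanish a c) (vanish b d)
    where
    vanish : ∀ a c → 0# * a + 0# * c ≡ 0#
    vanish = solve 2 (λ a c → :0 :* a :+ :0 :* c := :0) refl

  ·-distribʳ : ∀ u v A → (u ⊕ v) · A ≡ u · A ⊕ v · A
  ·-distribʳ (x , y) (x′ , y′) (mat a b c d) =
    cong₂ _,_ (distrib x y x′ y′ a c) (distrib x y x′ y′ b d)
    where
    distrib : ∀ x y x′ y′ a c → (x + x′) * a + (y + y′) * c ≡ (x * a + y * c) + (x′ * a + y′ * c)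
    distrib = solve 6 (λ x y x′ y′ a c → (x :+ x′) :* a :+ (y :+ y′) :* c
                                       := (x :* a :+ y :* c) :+ (x′ :* a :+ y′ :* c)) refl

  ⋆-· : ∀ k v A → (k ⋆ v) · A ≡ k ⋆ (v · A)
  ⋆-· k (x , y) (mat a b c d) = cong₂ _,_ (scale k x y a c) (scale k x y b d)
    where
    scale : ∀ k x y a c → k * x * a + k * y * c ≡ k * (x * a + y * c)
    scale = solve 5 (λ k x y a c → k :* x :* a :+ k :* y :* c := k :* (x :* a :+ y :* c)) refl

  ·-sub : ∀ v A B → v · (A -ᴹ B) ≡ v · A ⊖ v · B
  ·-sub (x , y) (mat a b c d) (mat a′ b′ c′ d′) =
    cong₂ _,_ (sub x y a c a′ c′) (sub x y b d b′ d′)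
    where
    sub : ∀ x y a c a′ c′ → x * (a - a′) + y * (c - c′) ≡ x * a + y * c - (x * a′ + y * c′)
    sub = solve 6 (λ x y a c a′ c′ → x :* (a :- a′) :+ y :* (c :- c′)
                                   := x :* a :+ y :* c :- (x :* a′ :+ y :* c′)) refl

  ·-assoc : ∀ v A B → v · A · B ≡ v · (A *ᴹ B)
  ·-assoc (x , y) (mat a b c d) (mat a′ b′ c′ d′) =
    cong₂ _,_ (assoc x y a b c d a′ c′) (assoc x y a b c d b′ d′)
    where
    assoc : ∀ x y a b c d p q →
            (x * a + y * c) * p + (x * b + y * d) * q ≡ x * (a * p + b * q) + y * (c * p + d * q)
    assoc = solve 8 (λ x y a b c d p q → (x :* a :+ y :* c) :* p :+ (x :* b :+ y :* d) :* q
                                       := x :* (a :* p :+ b :* q) :+ y :* (c :* p :+ d :* q)) refl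

  ·-identityʳ : ∀ v → v · 1ᴹ ≡ v
  ·-identityʳ (x , y) = cong₂ _,_ (solve 2 (λ x y → x :* :1 :+ y :* :0 := x) refl x y)
                                  (solve 2 (λ x y → x :* :0 :+ y :* :1 := y) refl x y)

  ·-·-cancel : ∀ {A B} → A *ᴹ B ≡ 1ᴹ → ∀ v → v · A · B ≡ v
  ·-·-cancel {A} {B} AB≡1 v = begin
    v · A · B     ≡⟨ ·-assoc v A B ⟩
    v · (A *ᴹ B)  ≡⟨ cong (v ·_) AB≡1 ⟩
    v · 1ᴹ        ≡⟨ ·-identityʳ v ⟩
    v             ∎

  -- The rows of A *ᴹ B are the rows of A multiplied by B, so matrix laws follow from the vector laws.

  *ᴹ-assoc : ∀ A B C → A *ᴹ B *ᴹ C ≡ A *ᴹ (B *ᴹ C)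
  *ᴹ-assoc (mat a b c d) B C = cong₂ rows (·-assoc (a , b) B C) (·-assoc (c , d) B C)

  *ᴹ-identityˡ : ∀ A → 1ᴹ *ᴹ A ≡ A
  *ᴹ-identityˡ A@(mat _ _ _ _) = cong₂ rows (e₁-· A) (e₂-· A)

  *ᴹ-identityʳ : ∀ A → A *ᴹ 1ᴹ ≡ A
  *ᴹ-identityʳ (mat a b c d) = cong₂ rows (·-identityʳ (a , b)) (·-identityʳ (c , d))

  scalar-comm : ∀ k A → A *ᴹ scalar k ≡ scalar k *ᴹ A
  scalar-comm k (mat a b c d) =
    cong₂ rows (cong₂ _,_ (left k a b c) (right k a b d)) (cong₂ _,_ (left′ k c d a) (right′ k c d b))
    where
    left : ∀ k x y z → x * k + y * 0# ≡ k * x + 0# * z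
    left = solve 4 (λ k x y z → x :* k :+ y :* :0 := k :* x :+ :0 :* z) refl
    right : ∀ k x y z → x * 0# + y * k ≡ k * y + 0# * z
    right = solve 4 (λ k x y z → x :* :0 :+ y :* k := k :* y :+ :0 :* z) refl
    left′ : ∀ k x y z → x * k + y * 0# ≡ 0# * z + k * x
    left′ = solve 4 (λ k x y z → x :* k :+ y :* :0 := :0 :* z :+ k :* x) refl
    right′ : ∀ k x y z → x * 0# + y * k ≡ 0# * z + k * y
    right′ = solve 4 (λ k x y z → x :* :0 :+ y :* k := :0 :* z :+ k :* y) refl

  det-*ᴹ : ∀ A B → det (A *ᴹ B) ≡ det A * det B
  det-*ᴹ (mat a b c d) (mat a′ b′ c′ d′) = solve 8
    (λ a b c d a′ b′ c′ d′ → (a :* a′ :+ b :* c′) :* (c :* b′ :+ d :* d′)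
                              :- (a :* b′ :+ b :* d′) :* (c :* a′ :+ d :* c′)
                           := (a :* d :- b :* c) :* (a′ :* d′ :- b′ :* c′))
    refl a b c d a′ b′ c′ d′

  det-1ᴹ : det 1ᴹ ≡ 1#
  det-1ᴹ = solve 0 (:1 :* :1 :- :0 :* :0 := :1) refl

  tr-comm : ∀ A B → tr (A *ᴹ B) ≡ tr (B *ᴹ A)
  tr-comm (mat a b c d) (mat a′ b′ c′ d′) = solve 8
    (λ a b c d a′ b′ c′ d′ → (a :* a′ :+ b :* c′) :+ (c :* b′ :+ d :* d′)
                           := (a′ :* a :+ b′ :* c) :+ (c′ :* b :+ d′ :* d))
    refl a b c d a′ b′ c′ d′

  inverse-*ᴹ : ∀ A → det A ≢ 0# → inverse A *ᴹ A ≡ 1ᴹ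
  inverse-*ᴹ A@(mat a b c d) det≢0 =
    cong₂ rows (cong₂ _,_ (trans (diag₁ a b c d δ) δD≡1) (off₁ a b c d δ))
               (cong₂ _,_ (off₂ a b c d δ) (trans (diag₂ a b c d δ) δD≡1))
    where
    δ = det A ⁻¹
    δD≡1 : δ * det A ≡ 1#
    δD≡1 = inverseˡ det≢0
    diag₁ : ∀ a b c d δ → δ * d * a + δ * - b * c ≡ δ * (a * d - b * c)
    diag₁ = solve 5 (λ a b c d δ → δ :* d :* a :+ δ :* :- b :* c := δ :* (a :* d :- b :* c)) refl
    diag₂ : ∀ a b c d δ → δ * - c * b + δ * a * d ≡ δ * (a * d - b * c)
    diag₂ = solve 5 (λ a b c d δ → δ :* :- c :* b :+ δ :* a :* d := δ :* (a :* d :- b :* c)) refl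
    off₁ : ∀ a b c d δ → δ * d * b + δ * - b * d ≡ 0#
    off₁ = solve 5 (λ a b c d δ → δ :* d :* b :+ δ :* :- b :* d := :0) refl
    off₂ : ∀ a b c d δ → δ * - c * a + δ * a * c ≡ 0#
    off₂ = solve 5 (λ a b c d δ → δ :* :- c :* a :+ δ :* a :* c := :0) refl

  *ᴹ-inverse : ∀ A → det A ≢ 0# → A *ᴹ inverse A ≡ 1ᴹ
  *ᴹ-inverse A@(mat a b c d) det≢0 =
    cong₂ rows (cong₂ _,_ (trans (diag₁ a b c d δ) δD≡1) (off₁ a b c d δ))
               (cong₂ _,_ (off₂ a b c d δ) (trans (diag₂ a b c d δ) δD≡1))
    where
    δ = det A ⁻¹
    δD≡1 : δ * det A ≡ 1#
    δD≡1 = inverseˡ det≢0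
    diag₁ : ∀ a b c d δ → a * (δ * d) + b * (δ * - c) ≡ δ * (a * d - b * c)
    diag₁ = solve 5 (λ a b c d δ → a :* (δ :* d) :+ b :* (δ :* :- c) := δ :* (a :* d :- b :* c)) refl
    diag₂ : ∀ a b c d δ → c * (δ * - b) + d * (δ * a) ≡ δ * (a * d - b * c)
    diag₂ = solve 5 (λ a b c d δ → c :* (δ :* :- b) :+ d :* (δ :* a) := δ :* (a :* d :- b :* c)) refl
    off₁ : ∀ a b c d δ → a * (δ * - b) + b * (δ * a) ≡ 0#
    off₁ = solve 5 (λ a b c d δ → a :* (δ :* :- b) :+ b :* (δ :* a) := :0) refl
    off₂ : ∀ a b c d δ → c * (δ * d) + d * (δ * - c) ≡ 0#
    off₂ = solve 5 (λ a b c d δ → c :* (δ :* d) :+ d :* (δ :* :- c) := :0) refl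

  *ᴹ-cancelˡ : ∀ {S A B} → det S ≢ 0# → S *ᴹ A ≡ S *ᴹ B → A ≡ B
  *ᴹ-cancelˡ {S} {A} {B} det≢0 SA≡SB = begin
    A                        ≡⟨ *ᴹ-identityˡ A ⟨
    1ᴹ *ᴹ A                  ≡⟨ cong (_*ᴹ A) (inverse-*ᴹ S det≢0) ⟨
    inverse S *ᴹ S *ᴹ A      ≡⟨ *ᴹ-assoc (inverse S) S A ⟩
    inverse S *ᴹ (S *ᴹ A)    ≡⟨ cong (inverse S *ᴹ_) SA≡SB ⟩
    inverse S *ᴹ (S *ᴹ B)    ≡⟨ *ᴹ-assoc (inverse S) S B ⟨
    inverse S *ᴹ S *ᴹ B      ≡⟨ cong (_*ᴹ B) (inverse-*ᴹ S det≢0) ⟩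
    1ᴹ *ᴹ B                  ≡⟨ *ᴹ-identityˡ B ⟩
    B                        ∎

  module _ {S T : Mat} where

    tr-similar : T *ᴹ S ≡ 1ᴹ → ∀ A → tr (S *ᴹ A *ᴹ T) ≡ tr A
    tr-similar TS≡1 A = begin
      tr (S *ᴹ A *ᴹ T)    ≡⟨ tr-comm (S *ᴹ A) T ⟩
      tr (T *ᴹ (S *ᴹ A))  ≡⟨ cong tr (*ᴹ-assoc T S A) ⟨
      tr (T *ᴹ S *ᴹ A)    ≡⟨ cong (λ B → tr (B *ᴹ A)) TS≡1 ⟩
      tr (1ᴹ *ᴹ A)        ≡⟨ cong tr (*ᴹ-identityˡ A) ⟩
      tr A                ∎

    det-similar : S *ᴹ T ≡ 1ᴹ → ∀ A → det (S *ᴹ A *ᴹ T) ≡ det A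
    det-similar ST≡1 A = begin
      det (S *ᴹ A *ᴹ T)          ≡⟨ det-*ᴹ (S *ᴹ A) T ⟩
      det (S *ᴹ A) * det T       ≡⟨ cong (_* det T) (det-*ᴹ S A) ⟩
      det S * det A * det T      ≡⟨ solve 3 (λ x y z → x :* y :* z := y :* (x :* z))
                                            refl (det S) (det A) (det T) ⟩
      det A * (det S * det T)    ≡⟨ cong (det A *_) (det-*ᴹ S T) ⟨
      det A * det (S *ᴹ T)       ≡⟨ cong (λ B → det A * det B) ST≡1 ⟩
      det A * det 1ᴹ             ≡⟨ cong (det A *_) det-1ᴹ ⟩
      det A * 1#                 ≡⟨ solve 1 (λ x → x :* :1 := x) refl (det A) ⟩
      det A                      ∎

    scalar-similar : S *ᴹ T ≡ 1ᴹ → ∀ k → S *ᴹ scalar k *ᴹ T ≡ scalar k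
    scalar-similar ST≡1 k = begin
      S *ᴹ scalar k *ᴹ T      ≡⟨ cong (_*ᴹ T) (scalar-comm k S) ⟩
      scalar k *ᴹ S *ᴹ T      ≡⟨ *ᴹ-assoc (scalar k) S T ⟩
      scalar k *ᴹ (S *ᴹ T)    ≡⟨ cong (scalar k *ᴹ_) ST≡1 ⟩
      scalar k *ᴹ 1ᴹ          ≡⟨ *ᴹ-identityʳ (scalar k) ⟩
      scalar k                ∎

  cayley-hamilton : ∀ v A → v · A · A ≡ tr A ⋆ (v · A) ⊕ (- det A) ⋆ v
  cayley-hamilton (x , y) (mat a b c d) = cong₂ _,_
    (solve 6 (λ x y a b c d → (x :* a :+ y :* c) :* a :+ (x :* b :+ y :* d) :* c
                              := (a :+ d) :* (x :* a :+ y :* c) :+ :- (a :* d :- b :* c) :* x) refl x y a b c d)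
    (solve 6 (λ x y a b c d → (x :* a :+ y :* c) :* b :+ (x :* b :+ y :* d) :* d
                              := (a :+ d) :* (x :* b :+ y :* d) :+ :- (a :* d :- b :* c) :* y) refl x y a b c d)

  collinear : ∀ {u w} → u ≢ zeroH → det (rows u w) ≡ 0# → ∃ λ l → w ≡ l ⋆ u
  collinear {α , β} {w₁ , w₂} u≢0 det≡0 with nonzero-component u≢0 | x-y≡0⇒x≡y det≡0
  ... | inj₁ α≢0 | αw₂≡βw₁ =
    w₁ * α ⁻¹ , cong₂ _,_ (x≡x*y⁻¹*y w₁ α≢0) (proportional α≢0 αw₂≡βw₁)
  ... | inj₂ β≢0 | αw₂≡βw₁ =
    w₂ * β ⁻¹ , cong₂ _,_ (proportional β≢0 (sym αw₂≡βw₁)) (x≡x*y⁻¹*y w₂ β≢0)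

  singular⇒kernel : ∀ A → det A ≡ 0# → ∃ λ v → v ≢ zeroH × v · A ≡ zeroH
  singular⇒kernel A@(mat a b c d) det≡0 with (a , b) ≟ᴴ zeroH
  ... | yes row₁≡0 = e₁ , e₁≢0 , trans (e₁-· A) row₁≡0
  ... | no  row₁≢0 with collinear {a , b} {c , d} row₁≢0 det≡0
  ...   | l , cd≡l⋆ab = (- l , 1#) , 1≢0 ∘ cong proj₂ ,
            cong₂ _,_ (trans (cong (λ z → - l * a + 1# * z) (cong proj₁ cd≡l⋆ab)) (vanish l a))
                      (trans (cong (λ z → - l * b + 1# * z) (cong proj₂ cd≡l⋆ab)) (vanish l b))
    where
    vanish : ∀ l x → - l * x + 1# * (l * x) ≡ 0#
    vanish = solve 2 (λ l x → :- l :* x :+ :1 :* (l :* x) := :0) refl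

  hallMatrix : H → Mat
  hallMatrix (m₁ , m₂) = mat m₁ m₂ (- (m₂ ⁻¹ * f m₁)) (r - m₁)

  slopeMatrix : H → Mat
  slopeMatrix (m₁ , m₂) with m₂ ≟ 0#
  ... | yes _ = scalar m₁
  ... | no  _ = hallMatrix (m₁ , m₂)

  ⊙-as-· : ∀ x m → x ⊙ m ≡ x · slopeMatrix m
  ⊙-as-· (x₁ , x₂) (m₁ , m₂) with m₂ ≟ 0#
  ... | yes _ = cong₂ _,_
    (solve 3 (λ x₁ x₂ m₁ → x₁ :* m₁ := x₁ :* m₁ :+ x₂ :* :0) refl x₁ x₂ m₁)
    (solve 3 (λ x₁ x₂ m₁ → x₂ :* m₁ := x₁ :* :0 :+ x₂ :* m₁) refl x₁ x₂ m₁)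
  ... | no  _ = cong₂ _,_
    (solve 5 (λ x₁ x₂ m₁ w fm → x₁ :* m₁ :- x₂ :* w :* fm := x₁ :* m₁ :+ x₂ :* :- (w :* fm))
             refl x₁ x₂ m₁ (m₂ ⁻¹) (f m₁))
    (solve 5 (λ x₁ x₂ m₁ m₂ r → x₁ :* m₂ :- x₂ :* m₁ :+ x₂ :* r := x₁ :* m₂ :+ x₂ :* (r :- m₁))
             refl x₁ x₂ m₁ m₂ r)

  slopeMatrix-type1 : ∀ {m} → proj₂ m ≡ 0# → slopeMatrix m ≡ scalar (proj₁ m)
  slopeMatrix-type1 {m₁ , m₂} m₂≡0 with m₂ ≟ 0#
  ... | yes _    = refl
  ... | no m₂≢0 = ⊥-elim (m₂≢0 m₂≡0)

  slopeMatrix-type2 : ∀ {m} → proj₂ m ≢ 0# → slopeMatrix m ≡ hallMatrix m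
  slopeMatrix-type2 {m₁ , m₂} m₂≢0 with m₂ ≟ 0#
  ... | yes m₂≡0 = ⊥-elim (m₂≢0 m₂≡0)
  ... | no _     = refl

  ⊙-hallMatrix : ∀ {m} → proj₂ m ≢ 0# → ∀ x → x ⊙ m ≡ x · hallMatrix m
  ⊙-hallMatrix {m} m₂≢0 x = trans (⊙-as-· x m) (cong (x ·_) (slopeMatrix-type2 m₂≢0))

  ⊙-distribʳ : ∀ x y m → (x ⊕ y) ⊙ m ≡ x ⊙ m ⊕ y ⊙ m
  ⊙-distribʳ x y m = begin
    (x ⊕ y) ⊙ m                            ≡⟨ ⊙-as-· (x ⊕ y) m ⟩
    (x ⊕ y) · slopeMatrix m                ≡⟨ ·-distribʳ x y (slopeMatrix m) ⟩
    x · slopeMatrix m ⊕ y · slopeMatrix m  ≡⟨ cong₂ _⊕_ (⊙-as-· x m) (⊙-as-· y m) ⟨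
    x ⊙ m ⊕ y ⊙ m                          ∎

  zero-⊙ : ∀ m → zeroH ⊙ m ≡ zeroH
  zero-⊙ m = trans (⊙-as-· zeroH m) (zero-· (slopeMatrix m))

  tr-hallMatrix : ∀ m → tr (hallMatrix m) ≡ r
  tr-hallMatrix (m₁ , _) = solve 2 (λ m₁ r → m₁ :+ (r :- m₁) := r) refl m₁ r

  det-hallMatrix : ∀ {m} → proj₂ m ≢ 0# → det (hallMatrix m) ≡ - s
  det-hallMatrix {m₁ , m₂} m₂≢0 = begin
    m₁ * (r - m₁) - m₂ * - (m₂ ⁻¹ * f m₁)  ≡⟨ regroup m₁ m₂ (m₂ ⁻¹) (f m₁) r ⟩
    m₁ * (r - m₁) + m₂ * m₂ ⁻¹ * f m₁      ≡⟨ cong (λ z → m₁ * (r - m₁) + z * f m₁) (inverseʳ m₂ m₂≢0) ⟩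
    m₁ * (r - m₁) + 1# * f m₁              ≡⟨ solve 3 (λ m₁ r s → m₁ :* (r :- m₁) :+ :1 :* (m₁ :* m₁ :- r :* m₁ :- s)
                                                             := :- s) refl m₁ r s ⟩
    - s                                    ∎
    where
    regroup : ∀ m₁ m₂ w fm r → m₁ * (r - m₁) - m₂ * - (w * fm) ≡ m₁ * (r - m₁) + m₂ * w * fm
    regroup = solve 5 (λ m₁ m₂ w fm r → m₁ :* (r :- m₁) :- m₂ :* :- (w :* fm)
                                      := m₁ :* (r :- m₁) :+ m₂ :* w :* fm) refl

  cayley-hamilton-hall : ∀ {m} → proj₂ m ≢ 0# → ∀ v →
                         v · hallMatrix m · hallMatrix m ≡ r ⋆ (v · hallMatrix m) ⊕ s ⋆ v
  cayley-hamilton-hall {m} m₂≢0 v = begin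
    v · M · M                            ≡⟨ cayley-hamilton v M ⟩
    tr M ⋆ (v · M) ⊕ (- det M) ⋆ v       ≡⟨ cong₂ (λ t d → t ⋆ (v · M) ⊕ (- d) ⋆ v)
                                                  (tr-hallMatrix m) (det-hallMatrix m₂≢0) ⟩
    r ⋆ (v · M) ⊕ (- - s) ⋆ v            ≡⟨ cong (λ z → r ⋆ (v · M) ⊕ z ⋆ v) (solve 1 (λ s → :- :- s := s) refl s) ⟩
    r ⋆ (v · M) ⊕ s ⋆ v                  ∎
    where M = hallMatrix m

  f-⋆-expand : ∀ l u → f l ⋆ u ≡ l ⋆ (l ⋆ u) ⊖ (r ⋆ (l ⋆ u) ⊕ s ⋆ u)
  f-⋆-expand l (u₁ , u₂) = cong₂ _,_ (expand l u₁ r s) (expand l u₂ r s)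
    where
    expand : ∀ l x r s → (l * l - r * l - s) * x ≡ l * (l * x) - (r * (l * x) + s * x)
    expand = solve 4 (λ l x r s → (l :* l :- r :* l :- s) :* x := l :* (l :* x) :- (r :* (l :* x) :+ s :* x)) refl

  e₂⊙ : ∀ μ {ψ} → ψ ≢ 0# → e₂ ⊙ (μ , ψ) ≡ (- f μ * ψ ⁻¹ , r - μ)
  e₂⊙ μ {ψ} ψ≢0 with ψ ≟ 0#
  ... | yes ψ≡0 = ⊥-elim (ψ≢0 ψ≡0)
  ... | no _    = cong₂ _,_
    (solve 3 (λ μ w fμ → :0 :* μ :- :1 :* w :* fμ := :- fμ :* w) refl μ (ψ ⁻¹) (f μ))
    (solve 3 (λ μ ψ r → :0 :* ψ :- :1 :* μ :+ :1 :* r := r :- μ) refl μ ψ r)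

  e₂⊙e₂ : e₂ ⊙ e₂ ≡ (s , r)
  e₂⊙e₂ = trans (e₂⊙ 0# 1≢0) (cong₂ _,_
    (trans (cong (- f 0# *_) 1⁻¹≡1) (solve 2 (λ r s → :- (:0 :* :0 :- r :* :0 :- s) :* :1 := s) refl r s))
    (solve 1 (λ r → r :- :0 := r) refl r))

  record Transports (φ : Point → Point) (ℓ L : Line) : Set where
    constructor transporting
    field at : ∀ P → P ∈L ℓ ⇔ φ P ∈L L

  open Transports

  transports-∘ : ∀ {φ ψ ℓ L L′} → Transports φ ℓ L → Transports ψ L L′ → Transports (ψ ∘ φ) ℓ L′
  transports-∘ {φ} φℓ≡L ψL≡L′ = transporting λ P → at ψL≡L′ (φ P) ⇔-∘ at φℓ≡L P

  record Automorphism : Set where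
    field
      onPoints   : Point ↔ Point
      onLines    : Line → Line
      transports : ∀ ℓ → Transports (Inverse.to onPoints) ℓ (onLines ℓ)

  open Automorphism

  apply : Automorphism → Point → Point
  apply α = Inverse.to (onPoints α)

  infixr 9 _∘ᴬ_
  _∘ᴬ_ : Automorphism → Automorphism → Automorphism
  β ∘ᴬ α = record
    { onPoints   = onPoints β ↔-∘ onPoints α
    ; onLines    = onLines β ∘ onLines α
    ; transports = λ ℓ → transports-∘ (transports α ℓ) (transports β (onLines α ℓ))
    }

  mapsOnto : ∀ α {ℓ L} → Transports (apply α) ℓ L → MapsOnto (apply α) ℓ L
  mapsOnto α {ℓ} {L} ℓ↦L Q = mk⇔
    (λ Q∈L → from Q ,
             Equivalence.from (at ℓ↦L (from Q)) (subst (_∈L L) (sym (strictlyInverseˡ Q)) Q∈L) ,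
             strictlyInverseˡ Q)
    (λ { (P , P∈ℓ , refl) → Equivalence.to (at ℓ↦L P) P∈ℓ })
    where open Inverse (onPoints α)

  collineation : ∀ α → Collineation (apply α)
  collineation α =
    Bijection.bijective (Inverse⇒Bijection (onPoints α)) , λ ℓ → onLines α ℓ , mapsOnto α (transports α ℓ)

  image-on-line : ∀ {φ ℓ m k P x} → Transports φ ℓ (nonvert m k) → P ∈L ℓ →
                  proj₁ (φ P) ≡ x → φ P ≡ (x , x ⊙ m ⊕ k)
  image-on-line {P = P} ℓ↦L P∈ℓ refl = cong (_ ,_) (Equivalence.to (at ℓ↦L P) P∈ℓ)

  translate : H → H → Point → Point
  translate u v (x , y) = (x ⊕ u , y ⊕ v)

  translateLine : H → H → Line → Line
  translateLine u v (nonvert m k) = nonvert m (k ⊕ v ⊖ u ⊙ m)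
  translateLine u v (vert c)      = vert (c ⊕ u)

  translate-transports : ∀ u v ℓ → Transports (translate u v) ℓ (translateLine u v ℓ)
  translate-transports u v (nonvert m k) = transporting λ { (x , y) → translated x y }
    where
    regroup : ∀ a b k v → a ⊕ b ⊕ (k ⊕ v ⊖ b) ≡ a ⊕ k ⊕ v
    regroup (a₁ , a₂) (b₁ , b₂) (k₁ , k₂) (v₁ , v₂) = cong₂ _,_ (L a₁ b₁ k₁ v₁) (L a₂ b₂ k₂ v₂)
      where
      L : ∀ a b k v → a + b + (k + v - b) ≡ a + k + v
      L = solve 4 (λ a b k v → a :+ b :+ (k :+ v :- b) := a :+ k :+ v) refl
    translated : ∀ x y → y ≡ x ⊙ m ⊕ k ⇔ y ⊕ v ≡ (x ⊕ u) ⊙ m ⊕ (k ⊕ v ⊖ u ⊙ m)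
    translated x y = mk⇔ (λ y≡xm+k → trans (cong (_⊕ v) y≡xm+k) (sym shifted))
                         (λ y+v≡image → ⊕-cancelʳ v (trans y+v≡image shifted))
      where
      shifted : (x ⊕ u) ⊙ m ⊕ (k ⊕ v ⊖ u ⊙ m) ≡ x ⊙ m ⊕ k ⊕ v
      shifted = trans (cong (_⊕ (k ⊕ v ⊖ u ⊙ m)) (⊙-distribʳ x u m)) (regroup (x ⊙ m) (u ⊙ m) k v)
  translate-transports u v (vert c) = transporting λ { (x , y) → mk⇔ (cong (_⊕ u)) (⊕-cancelʳ u) }

  translation : H → H → Automorphism
  translation u v = record
    { onPoints   = mk↔ₛ′ (translate u v) (translate (-ᴴ u) (-ᴴ v))
                     (λ { (x , y) → cong₂ _,_ (⊖-⊕-cancel x u) (⊖-⊕-cancel y v) })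
                     (λ { (x , y) → cong₂ _,_ (⊕-⊖-cancel x u) (⊕-⊖-cancel y v) })
    ; onLines    = translateLine u v
    ; transports = translate-transports u v
    }

  translate-to-origin : ∀ {m k p c} → (p , c) ∈L nonvert m k →
                        Transports (translate (-ᴴ p) (-ᴴ c)) (nonvert m k) (nonvert m zeroH)
  translate-to-origin {m} {k} {p} {c} P∈ℓ =
    subst (Transports _ (nonvert m k)) (cong (nonvert m) K≡0) (translate-transports (-ᴴ p) (-ᴴ c) (nonvert m k))
    where
    K = k ⊕ -ᴴ c ⊖ (-ᴴ p) ⊙ m
    K≡0 : K ≡ zeroH
    K≡0 = begin
      K                    ≡⟨ ⊕-identityˡ K ⟨
      zeroH ⊕ K            ≡⟨ cong (_⊕ K) (zero-⊙ m) ⟨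
      zeroH ⊙ m ⊕ K        ≡⟨ cong (λ x → x ⊙ m ⊕ K) (⊖-self p) ⟨
      (p ⊖ p) ⊙ m ⊕ K      ≡⟨ Equivalence.to (at (translate-transports _ _ (nonvert m k)) (p , c)) P∈ℓ ⟨
      c ⊖ c                ≡⟨ ⊖-self c ⟩
      zeroH                ∎

  translate-along-slope : ∀ u m k → Transports (translate u (u ⊙ m)) (nonvert m k) (nonvert m k)
  translate-along-slope u m k =
    subst (Transports _ (nonvert m k)) (cong (nonvert m) (⊕-⊖-cancel k (u ⊙ m)))
          (translate-transports u (u ⊙ m) (nonvert m k))

  module _ (irreducible : Irreducible F r s) where

    no-factorisation : ∀ p q → p + q ≡ r → p * q ≡ - s → ⊥
    no-factorisation p q p+q≡r pq≡-s = irreducible (1# , - p , 1# , - q , *-identityˡ 1# , linear , constant)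
      where
      linear : 1# * - q + - p * 1# ≡ - r
      linear = trans (solve 2 (λ p q → :1 :* :- q :+ :- p :* :1 := :- (p :+ q)) refl p q) (cong -_ p+q≡r)
      constant : - p * - q ≡ - s
      constant = trans (solve 2 (λ p q → :- p :* :- q := p :* q) refl p q) pq≡-s

    f-has-no-root : ∀ l → f l ≢ 0#
    f-has-no-root l fl≡0 = no-factorisation l (r - l) (solve 2 (λ l r → l :+ (r :- l) := r) refl l r) (begin
      l * (r - l)   ≡⟨ solve 3 (λ l r s → l :* (r :- l) := :- (l :* l :- r :* l :- s) :- s) refl l r s ⟩
      - f l - s     ≡⟨ cong (λ z → - z - s) fl≡0 ⟩
      - 0# - s      ≡⟨ solve 1 (λ s → :- :0 :- s := :- s) refl s ⟩
      - s           ∎)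

    -s≢0 : - s ≢ 0#
    -s≢0 -s≡0 = no-factorisation 0# r (+-identityˡ r) (begin
      0# * r  ≡⟨ solve 1 (λ r → :0 :* r := :0) refl r ⟩
      0#      ≡⟨ -s≡0 ⟨
      - s     ∎)

    companion : ∀ N → tr N ≡ r → det N ≡ - s → proj₂ (row₁ N) ≢ 0# × hallMatrix (row₁ N) ≡ N
    companion (mat a b c d) a+d≡r det≡-s = b≢0 , cong₂ rows refl (cong₂ _,_ c≡ d≡)
      where
      b≢0 : b ≢ 0#
      b≢0 b≡0 = no-factorisation a d a+d≡r (begin
        a * d           ≡⟨ solve 3 (λ a d c → a :* d := a :* d :- :0 :* c) refl a d c ⟩
        a * d - 0# * c  ≡⟨ cong (λ z → a * d - z * c) b≡0 ⟨
        a * d - b * c   ≡⟨ det≡-s ⟩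
        - s             ∎)
      d≡ : r - a ≡ d
      d≡ = trans (cong (_- a) (sym a+d≡r)) (solve 2 (λ a d → a :+ d :- a := d) refl a d)
      bc≡-fa : b * c ≡ - f a
      bc≡-fa = begin
        b * c                      ≡⟨ solve 4 (λ a b c d → b :* c := a :* d :- (a :* d :- b :* c)) refl a b c d ⟩
        a * d - (a * d - b * c)    ≡⟨ cong₂ (λ x y → a * x - y) (sym d≡) det≡-s ⟩
        a * (r - a) - - s          ≡⟨ solve 3 (λ a r s → a :* (r :- a) :- :- s := :- (a :* a :- r :* a :- s)) refl a r s ⟩
        - f a                      ∎
      c≡ : - (b ⁻¹ * f a) ≡ c
      c≡ = *-cancelˡ b b≢0 (begin
        b * - (b ⁻¹ * f a)   ≡⟨ solve 3 (λ b w x → b :* :- (w :* x) := :- (b :* w :* x)) refl b (b ⁻¹) (f a) ⟩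
        - (b * b ⁻¹ * f a)   ≡⟨ cong (λ z → - (z * f a)) (inverseʳ b b≢0) ⟩
        - (1# * f a)         ≡⟨ cong -_ (*-identityˡ (f a)) ⟩
        - f a                ≡⟨ bc≡-fa ⟨
        b * c                ∎)

    eigenvalue-is-root : ∀ {m u l} → proj₂ m ≢ 0# → u ≢ zeroH → u · hallMatrix m ≡ l ⋆ u → f l ≡ 0#
    eigenvalue-is-root {m} {u} {l} m₂≢0 u≢0 eigen = k⋆u≡0⇒k≡0 u≢0 (begin
      f l ⋆ u                                  ≡⟨ f-⋆-expand l u ⟩
      l ⋆ (l ⋆ u) ⊖ (r ⋆ (l ⋆ u) ⊕ s ⋆ u)      ≡⟨ cong (_⊖ (r ⋆ (l ⋆ u) ⊕ s ⋆ u)) squared ⟩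
      r ⋆ (l ⋆ u) ⊕ s ⋆ u ⊖ (r ⋆ (l ⋆ u) ⊕ s ⋆ u) ≡⟨ ⊖-self _ ⟩
      zeroH                                    ∎)
      where
      M = hallMatrix m
      squared : l ⋆ (l ⋆ u) ≡ r ⋆ (l ⋆ u) ⊕ s ⋆ u
      squared = begin
        l ⋆ (l ⋆ u)           ≡⟨ cong (l ⋆_) eigen ⟨
        l ⋆ (u · M)           ≡⟨ ⋆-· l u M ⟨
        (l ⋆ u) · M           ≡⟨ cong (_· M) eigen ⟨
        u · M · M             ≡⟨ cayley-hamilton-hall m₂≢0 u ⟩
        r ⋆ (u · M) ⊕ s ⋆ u   ≡⟨ cong (λ w → r ⋆ w ⊕ s ⋆ u) eigen ⟩
        r ⋆ (l ⋆ u) ⊕ s ⋆ u   ∎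

    independent : ∀ {m u} → proj₂ m ≢ 0# → u ≢ zeroH → det (rows u (u · hallMatrix m)) ≢ 0#
    independent m₂≢0 u≢0 det≡0 =
      f-has-no-root _ (eigenvalue-is-root m₂≢0 u≢0 (proj₂ (collinear u≢0 det≡0)))

    hallMatrix-injective : ∀ {m m′ v} → proj₂ m ≢ 0# → proj₂ m′ ≢ 0# → v ≢ zeroH →
                           v · hallMatrix m ≡ v · hallMatrix m′ → m ≡ m′
    hallMatrix-injective {m} {m′} {v} m₂≢0 m′₂≢0 v≢0 vM≡vM′ =
      cong row₁ (*ᴹ-cancelˡ (independent m₂≢0 v≢0) (cong₂ rows vM≡vM′ vMM≡vMM′))
      where
      M = hallMatrix m
      M′ = hallMatrix m′
      vMM≡vMM′ : v · M · M ≡ v · M · M′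
      vMM≡vMM′ = begin
        v · M · M              ≡⟨ cayley-hamilton-hall m₂≢0 v ⟩
        r ⋆ (v · M) ⊕ s ⋆ v    ≡⟨ cong (λ w → r ⋆ w ⊕ s ⋆ v) vM≡vM′ ⟩
        r ⋆ (v · M′) ⊕ s ⋆ v   ≡⟨ cayley-hamilton-hall m′₂≢0 v ⟨
        v · M′ · M′            ≡⟨ cong (_· M′) vM≡vM′ ⟨
        v · M · M′             ∎

    disjoint⇒same-slope : ∀ {m m′ k k′} → proj₂ m ≢ 0# → proj₂ m′ ≢ 0# →
                          (∀ x → x ⊙ m ⊕ k ≢ x ⊙ m′ ⊕ k′) → m ≡ m′
    disjoint⇒same-slope {m} {m′} {k} {k′} m₂≢0 m′₂≢0 disjoint
      with det (hallMatrix m -ᴹ hallMatrix m′) ≟ 0#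
    ... | yes det≡0 =
      let v , v≢0 , vD≡0 = singular⇒kernel (hallMatrix m -ᴹ hallMatrix m′) det≡0
      in hallMatrix-injective m₂≢0 m′₂≢0 v≢0 (⊖≡0⇒≡ (trans (sym (·-sub v _ _)) vD≡0))
    ... | no det≢0 = ⊥-elim (disjoint x₀ meet)
      where
      D = hallMatrix m -ᴹ hallMatrix m′
      x₀ = (k′ ⊖ k) · inverse D
      rearrange : ∀ {a b} → a ⊖ b ≡ k′ ⊖ k → a ⊕ k ≡ b ⊕ k′
      rearrange {a₁ , a₂} {b₁ , b₂} eq = cong₂ _,_ (L (cong proj₁ eq)) (L (cong proj₂ eq))
        where
        L : ∀ {a b k k′} → a - b ≡ k′ - k → a + k ≡ b + k′
        L {a} {b} {k} {k′} eq = begin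
          a + k             ≡⟨ solve 3 (λ a b k → a :+ k := a :- b :+ (b :+ k)) refl a b k ⟩
          a - b + (b + k)   ≡⟨ cong (_+ (b + k)) eq ⟩
          k′ - k + (b + k)  ≡⟨ solve 3 (λ b k k′ → k′ :- k :+ (b :+ k) := b :+ k′) refl b k k′ ⟩
          b + k′            ∎
      meet : x₀ ⊙ m ⊕ k ≡ x₀ ⊙ m′ ⊕ k′
      meet = begin
        x₀ ⊙ m ⊕ k                     ≡⟨ cong (_⊕ k) (⊙-hallMatrix m₂≢0 x₀) ⟩
        x₀ · hallMatrix m ⊕ k          ≡⟨ rearrange (trans (sym (·-sub x₀ _ _))
                                                           (·-·-cancel (inverse-*ᴹ D det≢0) (k′ ⊖ k))) ⟩
        x₀ · hallMatrix m′ ⊕ k′        ≡⟨ cong (_⊕ k′) (⊙-hallMatrix m′₂≢0 x₀) ⟨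
        x₀ ⊙ m′ ⊕ k′                   ∎

    module LinearAutomorphism {T S : Mat} (T*S≡1 : T *ᴹ S ≡ 1ᴹ) (S*T≡1 : S *ᴹ T ≡ 1ᴹ) where

      conjugate : H → H
      conjugate m = row₁ (S *ᴹ slopeMatrix m *ᴹ T)

      companion-conjugate : ∀ {m} → proj₂ m ≢ 0# →
        proj₂ (conjugate m) ≢ 0# × hallMatrix (conjugate m) ≡ S *ᴹ slopeMatrix m *ᴹ T
      companion-conjugate {m} m₂≢0 = companion (S *ᴹ slopeMatrix m *ᴹ T)
        (trans (tr-similar T*S≡1 (slopeMatrix m)) (trans (cong tr (slopeMatrix-type2 m₂≢0)) (tr-hallMatrix m)))
        (trans (det-similar S*T≡1 (slopeMatrix m)) (trans (cong det (slopeMatrix-type2 m₂≢0)) (det-hallMatrix m₂≢0)))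

      conjugate-type2 : ∀ {m} → proj₂ m ≢ 0# → proj₂ (conjugate m) ≢ 0#
      conjugate-type2 = proj₁ ∘ companion-conjugate

      slopeMatrix-conjugate : ∀ m → slopeMatrix (conjugate m) ≡ S *ᴹ slopeMatrix m *ᴹ T
      slopeMatrix-conjugate m = by-type (proj₂ m ≟ 0#)
        where
        N = S *ᴹ slopeMatrix m *ᴹ T
        by-type : Dec (proj₂ m ≡ 0#) → slopeMatrix (row₁ N) ≡ N
        by-type (yes m₂≡0) = begin
          slopeMatrix (row₁ N)        ≡⟨ cong (slopeMatrix ∘ row₁) N≡scalar ⟩
          slopeMatrix (proj₁ m , 0#)  ≡⟨ slopeMatrix-type1 refl ⟩
          scalar (proj₁ m)            ≡⟨ N≡scalar ⟨
          N                           ∎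
          where
          N≡scalar : N ≡ scalar (proj₁ m)
          N≡scalar = trans (cong (λ A → S *ᴹ A *ᴹ T) (slopeMatrix-type1 m₂≡0)) (scalar-similar S*T≡1 (proj₁ m))
        by-type (no m₂≢0) = let conj₂≢0 , hall≡N = companion-conjugate m₂≢0
                            in trans (slopeMatrix-type2 conj₂≢0) hall≡N

      ⊙-conjugate : ∀ m x → (x ⊙ m) · T ≡ (x · T) ⊙ conjugate m
      ⊙-conjugate m x = begin
        (x ⊙ m) · T                             ≡⟨ cong (_· T) (⊙-as-· x m) ⟩
        x · slopeMatrix m · T                   ≡⟨ cong (λ v → v · slopeMatrix m · T) (·-·-cancel T*S≡1 x) ⟨
        x · T · S · slopeMatrix m · T           ≡⟨ cong (_· T) (·-assoc (x · T) S (slopeMatrix m)) ⟩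
        x · T · (S *ᴹ slopeMatrix m) · T        ≡⟨ ·-assoc (x · T) (S *ᴹ slopeMatrix m) T ⟩
        x · T · (S *ᴹ slopeMatrix m *ᴹ T)       ≡⟨ cong (x · T ·_) (slopeMatrix-conjugate m) ⟨
        x · T · slopeMatrix (conjugate m)       ≡⟨ ⊙-as-· (x · T) (conjugate m) ⟨
        (x · T) ⊙ conjugate m                   ∎

      ·T-injective : ∀ {u v} → u · T ≡ v · T → u ≡ v
      ·T-injective {u} {v} uT≡vT = begin
        u          ≡⟨ ·-·-cancel T*S≡1 u ⟨
        u · T · S  ≡⟨ cong (_· S) uT≡vT ⟩
        v · T · S  ≡⟨ ·-·-cancel T*S≡1 v ⟩
        v          ∎

      transform : Point → Point
      transform (x , y) = (x · T , y · T)

      transformLine : Line → Line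
      transformLine (nonvert m k) = nonvert (conjugate m) (k · T)
      transformLine (vert c)      = vert (c · T)

      transform-transports : ∀ ℓ → Transports transform ℓ (transformLine ℓ)
      transform-transports (nonvert m k) = transporting λ { (x , y) → transformed x y }
        where
        transformed : ∀ x y → y ≡ x ⊙ m ⊕ k ⇔ y · T ≡ (x · T) ⊙ conjugate m ⊕ k · T
        transformed x y = mk⇔ (λ y≡xm+k → trans (cong (_· T) y≡xm+k) image)
                              (λ yT≡image → ·T-injective (trans yT≡image (sym image)))
          where
          image : (x ⊙ m ⊕ k) · T ≡ (x · T) ⊙ conjugate m ⊕ k · T
          image = trans (·-distribʳ (x ⊙ m) k T) (cong (_⊕ k · T) (⊙-conjugate m x))
      transform-transports (vert c) = transporting λ { (x , y) → mk⇔ (cong (_· T)) ·T-injective }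

      linear : Automorphism
      linear = record
        { onPoints   = mk↔ₛ′ transform (λ { (x , y) → (x · S , y · S) })
                         (λ { (x , y) → cong₂ _,_ (·-·-cancel S*T≡1 x) (·-·-cancel S*T≡1 y) })
                         (λ { (x , y) → cong₂ _,_ (·-·-cancel T*S≡1 x) (·-·-cancel T*S≡1 y) })
        ; onLines    = transformLine
        ; transports = transform-transports
        }

    module BasisChange {m₀ u : H} (m₀₂≢0 : proj₂ m₀ ≢ 0#) (u≢0 : u ≢ zeroH) where

      S T : Mat
      S = rows u (u · hallMatrix m₀)
      T = inverse S

      det-S≢0 : det S ≢ 0#
      det-S≢0 = independent m₀₂≢0 u≢0

      open LinearAutomorphism (inverse-*ᴹ S det-S≢0) (*ᴹ-inverse S det-S≢0) public

      uM₀T≡e₂ : u · hallMatrix m₀ · T ≡ e₂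
      uM₀T≡e₂ = begin
        u · hallMatrix m₀ · T  ≡⟨ cong (_· T) (e₂-· S) ⟨
        e₂ · S · T             ≡⟨ ·-·-cancel (*ᴹ-inverse S det-S≢0) e₂ ⟩
        e₂                     ∎

      conjugate-m₀ : conjugate m₀ ≡ e₂
      conjugate-m₀ = begin
        row₁ (S *ᴹ slopeMatrix m₀ *ᴹ T)     ≡⟨ e₁-· _ ⟨
        e₁ · (S *ᴹ slopeMatrix m₀ *ᴹ T)     ≡⟨ ·-assoc e₁ (S *ᴹ slopeMatrix m₀) T ⟨
        e₁ · (S *ᴹ slopeMatrix m₀) · T      ≡⟨ cong (_· T) (·-assoc e₁ S (slopeMatrix m₀)) ⟨
        e₁ · S · slopeMatrix m₀ · T         ≡⟨ cong (λ v → v · slopeMatrix m₀ · T) (e₁-· S) ⟩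
        u · slopeMatrix m₀ · T              ≡⟨ cong (λ A → u · A · T) (slopeMatrix-type2 m₀₂≢0) ⟩
        u · hallMatrix m₀ · T               ≡⟨ uM₀T≡e₂ ⟩
        e₂                                  ∎

      m₀↦e₂ : ∀ k → Transports (apply linear) (nonvert m₀ k) (nonvert e₂ (k · T))
      m₀↦e₂ k = subst (λ m → Transports transform (nonvert m₀ k) (nonvert m (k · T))) conjugate-m₀
                      (transform-transports (nonvert m₀ k))

      origin↦origin : ∀ m → Transports (apply linear) (nonvert m zeroH) (nonvert (conjugate m) zeroH)
      origin↦origin m = subst (λ k → Transports transform (nonvert m zeroH) (nonvert (conjugate m) k)) (zero-· T)
                              (transform-transports (nonvert m zeroH))

      m₀↦e₂-origin : Transports (apply linear) (nonvert m₀ zeroH) (nonvert e₂ zeroH)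
      m₀↦e₂-origin = subst (λ m → Transports transform (nonvert m₀ zeroH) (nonvert m zeroH)) conjugate-m₀
                           (origin↦origin m₀)

    -- Neither case needs the hypothesis ¬ SameLine ℓ ℓ′.
    intersecting-case : ∀ (ℓ ℓ′ : Line) (A : Point) → InNBF ℓ → InNBF ℓ′ → ¬ SameLine ℓ ℓ′ →
       (∃ λ P → P ∈L ℓ × P ∈L ℓ′) → A ∈L ℓ → (∀ P → P ∈L ℓ → P ∈L ℓ′ → ¬ A ≡ P) →
       Σ Carrier λ μ → Σ Carrier λ ψ → ¬ ψ ≡ 0# ×
         (∃ λ φ → Collineation φ
           × MapsOnto φ ℓ (nonvert (μ , ψ) zeroH)
           × MapsOnto φ ℓ′ (nonvert e₂ zeroH)
           × φ A ≡ (e₂ , (- f μ * ψ ⁻¹ , r - μ)))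
    intersecting-case (vert _)      _              _ ()  _    _ _ _ _
    intersecting-case (nonvert _ _) (vert _)       _ _   ()   _ _ _ _
    intersecting-case (nonvert m k) (nonvert m′ k′) (a , b) m₂≢0 m′₂≢0 _ ((p , c) , P∈ℓ , P∈ℓ′) A∈ℓ A≢P =
      proj₁ μψ , proj₂ μψ , conjugate-type2 m₂≢0 ,
      apply φ , collineation φ , mapsOnto φ ℓ↦ , mapsOnto φ ℓ′↦ ,
      trans (image-on-line ℓ↦ A∈ℓ a′T≡e₂)
            (cong (e₂ ,_) (trans (⊕-identityʳ _) (e₂⊙ (proj₁ μψ) (conjugate-type2 m₂≢0))))
      where
      a′ = a ⊖ p
      a′≢0 : a′ ≢ zeroH
      a′≢0 a′≡0 =
        A≢P (p , c) P∈ℓ P∈ℓ′ (cong₂ _,_ a≡p (trans A∈ℓ (trans (cong (λ x → x ⊙ m ⊕ k) a≡p) (sym P∈ℓ))))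
        where a≡p = ⊖≡0⇒≡ a′≡0
      M′ = hallMatrix m′
      det-M′≢0 : det M′ ≢ 0#
      det-M′≢0 det≡0 = -s≢0 (trans (sym (det-hallMatrix m′₂≢0)) det≡0)
      -- Chosen with u · M′ ≡ a′, so that the change of basis below sends a′ to e₂.
      u = a′ · inverse M′
      uM′≡a′ : u · M′ ≡ a′
      uM′≡a′ = ·-·-cancel (inverse-*ᴹ M′ det-M′≢0) a′
      u≢0 : u ≢ zeroH
      u≢0 u≡0 = a′≢0 (trans (sym uM′≡a′) (trans (cong (_· M′) u≡0) (zero-· M′)))
      open BasisChange m′₂≢0 u≢0
      μψ = conjugate m
      φ = linear ∘ᴬ translation (-ᴴ p) (-ᴴ c)
      ℓ↦ : Transports (apply φ) (nonvert m k) (nonvert μψ zeroH)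
      ℓ↦ = transports-∘ (translate-to-origin P∈ℓ) (origin↦origin m)
      ℓ′↦ : Transports (apply φ) (nonvert m′ k′) (nonvert e₂ zeroH)
      ℓ′↦ = transports-∘ (translate-to-origin P∈ℓ′) m₀↦e₂-origin
      a′T≡e₂ : a′ · T ≡ e₂
      a′T≡e₂ = trans (cong (_· T) (sym uM′≡a′)) uM₀T≡e₂

    parallel-case : ∀ (ℓ ℓ′ : Line) (A : Point) → InNBF ℓ → InNBF ℓ′ → ¬ SameLine ℓ ℓ′ →
       (∀ P → P ∈L ℓ → ¬ P ∈L ℓ′) → A ∈L ℓ →
       Σ Carrier λ κ₁ → Σ Carrier λ κ₂ →
         (∃ λ φ → Collineation φ
           × MapsOnto φ ℓ (nonvert e₂ (κ₁ , κ₂))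
           × MapsOnto φ ℓ′ (nonvert e₂ zeroH)
           × φ A ≡ (e₂ , (κ₁ + s , κ₂ + r)))
    parallel-case (vert _)      _              _ ()  _    _ _ _
    parallel-case (nonvert _ _) (vert _)       _ _   ()   _ _ _
    parallel-case (nonvert m k) (nonvert m′ k′) (a , b) m₂≢0 m′₂≢0 _ disjoint A∈ℓ
      with disjoint⇒same-slope m₂≢0 m′₂≢0 (λ x → disjoint (x , x ⊙ m ⊕ k) refl)
    ... | refl =
      proj₁ κ , proj₂ κ ,
      apply φ , collineation φ , mapsOnto φ ℓ↦ , mapsOnto φ ℓ′↦ ,
      trans (image-on-line ℓ↦ A∈ℓ first≡e₂) (cong (e₂ ,_) (trans (cong (_⊕ κ) e₂⊙e₂) (⊕-comm (s , r) κ)))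
      where
      c = a ⊙ m ⊕ k′
      open BasisChange m₂≢0 e₁≢0
      κ = (k ⊕ -ᴴ c ⊖ (-ᴴ a) ⊙ m) · T
      φ = translation e₂ (e₂ ⊙ e₂) ∘ᴬ linear ∘ᴬ translation (-ᴴ a) (-ᴴ c)
      ℓ↦ : Transports (apply φ) (nonvert m k) (nonvert e₂ κ)
      ℓ↦ = transports-∘ (transports-∘ (translate-transports (-ᴴ a) (-ᴴ c) (nonvert m k)) (m₀↦e₂ _))
                        (translate-along-slope e₂ e₂ κ)
      ℓ′↦ : Transports (apply φ) (nonvert m k′) (nonvert e₂ zeroH)
      ℓ′↦ = transports-∘ (transports-∘ (translate-to-origin {p = a} refl) m₀↦e₂-origin)
                         (translate-along-slope e₂ e₂ zeroH)
      first≡e₂ : (a ⊖ a) · T ⊕ e₂ ≡ e₂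
      first≡e₂ = begin
        (a ⊖ a) · T ⊕ e₂   ≡⟨ cong (λ v → v · T ⊕ e₂) (⊖-self a) ⟩
        zeroH · T ⊕ e₂     ≡⟨ cong (_⊕ e₂) (zero-· T) ⟩
        zeroH ⊕ e₂         ≡⟨ ⊕-identityˡ e₂ ⟩
        e₂                 ∎

proposition2p8 :
    (F : FiniteField) (r s : FiniteField.Carrier F) → Irreducible F r s →
    let open FiniteField F in let open Hall F r s in
    -- (i) two distinct intersecting NBF lines, A on ℓ other than ℓ ∩ ℓ'
    (∀ (ℓ ℓ' : Line) (A : Point) → InNBF ℓ → InNBF ℓ' → ¬ SameLine ℓ ℓ' →
       (∃ λ P → P ∈L ℓ × P ∈L ℓ') → A ∈L ℓ → (∀ P → P ∈L ℓ → P ∈L ℓ' → ¬ A ≡ P) →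
       Σ Carrier λ μ → Σ Carrier λ ψ → ¬ ψ ≡ 0# ×
         (∃ λ φ → Collineation φ
           × MapsOnto φ ℓ (nonvert (μ , ψ) zeroH)
           × MapsOnto φ ℓ' (nonvert e₂ zeroH)
           × φ A ≡ (e₂ , (- f μ * ψ ⁻¹ , r - μ))))
    ×
    -- (ii) two distinct parallel NBF lines, A on ℓ
    (∀ (ℓ ℓ' : Line) (A : Point) → InNBF ℓ → InNBF ℓ' → ¬ SameLine ℓ ℓ' →
       (∀ P → P ∈L ℓ → ¬ P ∈L ℓ') → A ∈L ℓ →
       Σ Carrier λ κ₁ → Σ Carrier λ κ₂ →
         (∃ λ φ → Collineation φ
           × MapsOnto φ ℓ (nonvert e₂ (κ₁ , κ₂))
           × MapsOnto φ ℓ' (nonvert e₂ zeroH)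
           × φ A ≡ (e₂ , (κ₁ + s , κ₂ + r))))
proposition2p8 F r s irreducible =
  HallPlane.intersecting-case F r s irreducible , HallPlane.parallel-case F r s irreducible
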